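{- Let $X$ be a commutable set, $s\in\mathcal{S}X$ a string and $e\in\mathcal{T}X$ a term. Then $s\le e$ in $\mathcal{T}X$ if and only if $s\in l(e)$.
   Context: Pre-Kleene algebra: constants $0,1$, operations $+,\cdot,{}^*$ with $(+,0)$ a commutative idempotent monoid, $(\cdot,1)$ a monoid, two-sided distributivity, $0$ absorbing, and $x^*=1+xx^*$; order $x\le y$ iff $x+y=y$. A commutable set is a set $X$ with a reflexive symmetric relation $\sim$. $\mathcal{S}X$ is the monoid of strings over $X$ modulo the congruence generated by $xy=yx$ for $x\sim y$; $\mathcal{T}X$ is the pre-Kleene algebra freely generated by $X$ subject to $xy=yx$ for $x\sim y$, into which $\mathcal{S}X$ embeds. $\mathcal{L}X$ is the smallest subalgebra of the power set of $\mathcal{S}X$ (with $\emptyset,\{1\},\cup$, elementwise concatenation, $A^*=\bigcup_nA^n$) containing all singletons, and $l:\mathcal{T}X\to\mathcal{L}X$ is the unique morphism of pre-Kleene algebras with $l(x)=\{x\}$. -}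

module Defs where

open import Data.List using (List; []; _∷_; [_]; _++_)
open import Data.Nat using (ℕ; zero; suc)
open import Data.Empty using (⊥)
open import Data.Sum using (_⊎_)
open import Data.Product using (Σ; _×_; ∃-syntax)

record CommutableSet : Set₁ where
  field
    Carrier : Set
    _∼_     : Carrier → Carrier → Set
    ∼-refl  : ∀ {x} → x ∼ x
    ∼-sym   : ∀ {x y} → x ∼ y → y ∼ x

module Free (X : CommutableSet) where
  open CommutableSet X

  -- 𝒮X : strings over X modulo the congruence generated by
  -- xy = yx for x ∼ y.  Represented by lists with the equivalence _≈S_.
  Str : Set
  Str = List Carrier

  infix 4 _≈S_
  data _≈S_ : Str → Str → Set where
    ≈S-refl  : ∀ {s} → s ≈S s
    ≈S-sym   : ∀ {s t} → s ≈S t → t ≈S s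
    ≈S-trans : ∀ {s t u} → s ≈S t → t ≈S u → s ≈S u
    ≈S-swap  : ∀ u {x y} v → x ∼ y →
               (u ++ x ∷ y ∷ v) ≈S (u ++ y ∷ x ∷ v)

  -- 𝒯X : pre-Kleene algebra freely generated by X subject to
  -- xy = yx for x ∼ y.  Terms modulo the congruence _≈_.
  infixl 6 _⊕_
  infixl 7 _⊙_
  data Term : Set where
    var  : Carrier → Term
    𝟘 𝟙  : Term
    _⊕_  : Term → Term → Term
    _⊙_  : Term → Term → Term
    _⋆   : Term → Term

  infix 4 _≈_
  data _≈_ : Term → Term → Set where
    ≈-refl  : ∀ {e} → e ≈ e
    ≈-sym   : ∀ {e f} → e ≈ f → f ≈ e
    ≈-trans : ∀ {e f g} → e ≈ f → f ≈ g → e ≈ g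
    ⊕-cong  : ∀ {e e' f f'} → e ≈ e' → f ≈ f' → e ⊕ f ≈ e' ⊕ f'
    ⊙-cong  : ∀ {e e' f f'} → e ≈ e' → f ≈ f' → e ⊙ f ≈ e' ⊙ f'
    ⋆-cong  : ∀ {e e'} → e ≈ e' → e ⋆ ≈ e' ⋆
    ⊕-assoc : ∀ e f g → (e ⊕ f) ⊕ g ≈ e ⊕ (f ⊕ g)
    ⊕-comm  : ∀ e f → e ⊕ f ≈ f ⊕ e
    ⊕-idem  : ∀ e → e ⊕ e ≈ e
    ⊕-idʳ   : ∀ e → e ⊕ 𝟘 ≈ e
    ⊙-assoc : ∀ e f g → (e ⊙ f) ⊙ g ≈ e ⊙ (f ⊙ g)
    ⊙-idˡ   : ∀ e → 𝟙 ⊙ e ≈ e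
    ⊙-idʳ   : ∀ e → e ⊙ 𝟙 ≈ e
    distribˡ : ∀ e f g → e ⊙ (f ⊕ g) ≈ (e ⊙ f) ⊕ (e ⊙ g)
    distribʳ : ∀ e f g → (f ⊕ g) ⊙ e ≈ (f ⊙ e) ⊕ (g ⊙ e)
    zeroˡ   : ∀ e → 𝟘 ⊙ e ≈ 𝟘
    zeroʳ   : ∀ e → e ⊙ 𝟘 ≈ 𝟘
    ⋆-unfold : ∀ e → e ⋆ ≈ 𝟙 ⊕ (e ⊙ (e ⋆))
    comm    : ∀ {x y} → x ∼ y → var x ⊙ var y ≈ var y ⊙ var x

  infix 4 _≤_
  _≤_ : Term → Term → Set
  e ≤ f = e ⊕ f ≈ f

  ⌜_⌝ : Str → Term
  ⌜ [] ⌝    = 𝟙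
  ⌜ x ∷ s ⌝ = var x ⊙ ⌜ s ⌝

  -- l : 𝒯X → ℒX ⊆ 𝒫(𝒮X), the pre-Kleene morphism with l(x) = {x},
  -- given by its (forced) structural clauses; s ∈l e means [s] ∈ l(e).
  infix 4 _∈l_ _∈pow_^_
  mutual
    _∈l_ : Str → Term → Set
    s ∈l var x   = s ≈S [ x ]
    s ∈l 𝟘       = ⊥
    s ∈l 𝟙       = s ≈S []
    s ∈l (e ⊕ f) = s ∈l e ⊎ s ∈l f
    s ∈l (e ⊙ f) = ∃[ u ] ∃[ v ] (u ∈l e × v ∈l f × s ≈S u ++ v)
    s ∈l (e ⋆)   = ∃[ n ] (s ∈pow e ^ n)

    _∈pow_^_ : Str → Term → ℕ → Set
    s ∈pow e ^ zero  = s ≈S []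
    s ∈pow e ^ suc n = ∃[ u ] ∃[ v ] (u ∈l e × v ∈pow e ^ n × s ≈S u ++ v)

-- The language map l is sound for the axioms of 𝒯X, and s ∈ l ⌜ s ⌝; so ⌜ s ⌝ ⊕ e ≈ e
-- forces s ∈ l e. Conversely, by induction on e every word of l e lies below e: ⌜_⌝ is a
-- monoid morphism identifying commuting strings, product is monotone, and the star
-- unfolding e ⋆ ≈ 𝟙 ⊕ e ⊙ e ⋆ puts every word of l(e)ⁿ below e ⋆.
module Submission where

open import Defs
open import Function.Base using (id; _∘_)
open import Function.Bundles using (_⇔_; mk⇔)
open import Data.List using ([]; _∷_; [_]; _++_)
open import Data.List.Properties using (++-assoc; ++-identityʳ)
open import Data.Nat using (zero; suc)
open import Data.Sum using (inj₁; inj₂; [_,_]′; reduce; swap; assocʳ; assocˡ)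
import Data.Sum as Sum
open import Data.Product using (_×_; _,_; proj₁; proj₂)
import Data.Product as Product
open import Relation.Binary.PropositionalEquality using (_≡_; refl; sym)

module Language (X : CommutableSet) where
  open CommutableSet X
  open Free X

  ≡⇒≈S : ∀ {s t} → s ≡ t → s ≈S t
  ≡⇒≈S refl = ≈S-refl

  ≈S-++ˡ : ∀ {s t} w → s ≈S t → s ++ w ≈S t ++ w
  ≈S-++ˡ w ≈S-refl         = ≈S-refl
  ≈S-++ˡ w (≈S-sym p)      = ≈S-sym (≈S-++ˡ w p)
  ≈S-++ˡ w (≈S-trans p q)  = ≈S-trans (≈S-++ˡ w p) (≈S-++ˡ w q)
  ≈S-++ˡ w (≈S-swap u {x} {y} v p) =
    ≈S-trans (≡⇒≈S (++-assoc u (x ∷ y ∷ v) w))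
      (≈S-trans (≈S-swap u (v ++ w) p) (≡⇒≈S (sym (++-assoc u (y ∷ x ∷ v) w))))

  ≈S-++ʳ : ∀ {s t} w → s ≈S t → w ++ s ≈S w ++ t
  ≈S-++ʳ w ≈S-refl         = ≈S-refl
  ≈S-++ʳ w (≈S-sym p)      = ≈S-sym (≈S-++ʳ w p)
  ≈S-++ʳ w (≈S-trans p q)  = ≈S-trans (≈S-++ʳ w p) (≈S-++ʳ w q)
  ≈S-++ʳ w (≈S-swap u {x} {y} v p) =
    ≈S-trans (≡⇒≈S (sym (++-assoc w u (x ∷ y ∷ v))))
      (≈S-trans (≈S-swap (w ++ u) v p) (≡⇒≈S (++-assoc w u (y ∷ x ∷ v))))

  ≈S-++ : ∀ {s s' t t'} → s ≈S s' → t ≈S t' → s ++ t ≈S s' ++ t'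
  ≈S-++ {s' = s'} {t = t} p q = ≈S-trans (≈S-++ˡ t p) (≈S-++ʳ s' q)

  mutual
    ∈l-resp-≈S : ∀ e {s t} → s ≈S t → s ∈l e → t ∈l e
    ∈l-resp-≈S (var x) p q                      = ≈S-trans (≈S-sym p) q
    ∈l-resp-≈S 𝟘       p ()
    ∈l-resp-≈S 𝟙       p q                      = ≈S-trans (≈S-sym p) q
    ∈l-resp-≈S (e ⊕ f) p q                      = Sum.map (∈l-resp-≈S e p) (∈l-resp-≈S f p) q
    ∈l-resp-≈S (e ⊙ f) p (u , v , a , b , q)    = u , v , a , b , ≈S-trans (≈S-sym p) q
    ∈l-resp-≈S (e ⋆)   p (n , q)                = n , ∈pow-resp-≈S e n p q

    ∈pow-resp-≈S : ∀ e n {s t} → s ≈S t → s ∈pow e ^ n → t ∈pow e ^ n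
    ∈pow-resp-≈S e zero    p q                   = ≈S-trans (≈S-sym p) q
    ∈pow-resp-≈S e (suc n) p (u , v , a , b , q) = u , v , a , b , ≈S-trans (≈S-sym p) q

  infix 4 _⊆l_ _≐l_
  _⊆l_ : Term → Term → Set
  e ⊆l f = ∀ {s} → s ∈l e → s ∈l f

  _≐l_ : Term → Term → Set
  e ≐l f = e ⊆l f × f ⊆l e

  ⊆l-trans : ∀ {e f g} → e ⊆l f → f ⊆l g → e ⊆l g
  ⊆l-trans p q = q ∘ p

  ⊕-mono-⊆l : ∀ {e e' f f'} → e ⊆l e' → f ⊆l f' → e ⊕ f ⊆l e' ⊕ f'
  ⊕-mono-⊆l p q = Sum.map p q

  ⊙-mono-⊆l : ∀ {e e' f f'} → e ⊆l e' → f ⊆l f' → e ⊙ f ⊆l e' ⊙ f'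
  ⊙-mono-⊆l p q (u , v , a , b , r) = u , v , p a , q b , r

  pow-mono-⊆l : ∀ {e f} → e ⊆l f → ∀ n {s} → s ∈pow e ^ n → s ∈pow f ^ n
  pow-mono-⊆l p zero    q                   = q
  pow-mono-⊆l p (suc n) (u , v , a , b , r) = u , v , p a , pow-mono-⊆l p n b , r

  ⋆-mono-⊆l : ∀ {e f} → e ⊆l f → e ⋆ ⊆l f ⋆
  ⋆-mono-⊆l p (n , q) = n , pow-mono-⊆l p n q

  ⊙-assoc-⊆l : ∀ e f g → (e ⊙ f) ⊙ g ⊆l e ⊙ (f ⊙ g)
  ⊙-assoc-⊆l e f g (u , v , (u₁ , u₂ , a , b , r) , c , q) =
    u₁ , u₂ ++ v , a , (u₂ , v , b , c , ≈S-refl) ,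
    ≈S-trans q (≈S-trans (≈S-++ˡ v r) (≡⇒≈S (++-assoc u₁ u₂ v)))

  ⊙-assoc⁻¹-⊆l : ∀ e f g → e ⊙ (f ⊙ g) ⊆l (e ⊙ f) ⊙ g
  ⊙-assoc⁻¹-⊆l e f g (u , v , a , (v₁ , v₂ , b , c , r) , q) =
    u ++ v₁ , v₂ , (u , v₁ , a , b , ≈S-refl) , c ,
    ≈S-trans q (≈S-trans (≈S-++ʳ u r) (≡⇒≈S (sym (++-assoc u v₁ v₂))))

  ⊙-idˡ-≐l : ∀ e → 𝟙 ⊙ e ≐l e
  ⊙-idˡ-≐l e =
    (λ { (u , v , u≈[] , b , q) → ∈l-resp-≈S e (≈S-sym (≈S-trans q (≈S-++ˡ v u≈[]))) b }) ,
    (λ {s} p → [] , s , ≈S-refl , p , ≈S-refl)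

  ⊙-idʳ-≐l : ∀ e → e ⊙ 𝟙 ≐l e
  ⊙-idʳ-≐l e =
    (λ { (u , v , a , v≈[] , q) →
           ∈l-resp-≈S e
             (≈S-sym (≈S-trans q (≈S-trans (≈S-++ʳ u v≈[]) (≡⇒≈S (++-identityʳ u))))) a }) ,
    (λ {s} p → s , [] , p , ≈S-refl , ≡⇒≈S (sym (++-identityʳ s)))

  distribˡ-⊆l : ∀ e f g → e ⊙ (f ⊕ g) ⊆l e ⊙ f ⊕ e ⊙ g
  distribˡ-⊆l e f g (u , v , a , b , q) = Sum.map (λ b → u , v , a , b , q) (λ b → u , v , a , b , q) b

  distribˡ⁻¹-⊆l : ∀ e f g → e ⊙ f ⊕ e ⊙ g ⊆l e ⊙ (f ⊕ g)
  distribˡ⁻¹-⊆l e f g = [ ⊙-mono-⊆l id inj₁ , ⊙-mono-⊆l id inj₂ ]′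

  distribʳ-⊆l : ∀ e f g → (f ⊕ g) ⊙ e ⊆l f ⊙ e ⊕ g ⊙ e
  distribʳ-⊆l e f g (u , v , a , b , q) = Sum.map (λ a → u , v , a , b , q) (λ a → u , v , a , b , q) a

  distribʳ⁻¹-⊆l : ∀ e f g → f ⊙ e ⊕ g ⊙ e ⊆l (f ⊕ g) ⊙ e
  distribʳ⁻¹-⊆l e f g = [ ⊙-mono-⊆l inj₁ id , ⊙-mono-⊆l inj₂ id ]′

  ⋆-unfold-≐l : ∀ e → e ⋆ ≐l 𝟙 ⊕ e ⊙ e ⋆
  ⋆-unfold-≐l e =
    (λ { (zero , q) → inj₁ q ; (suc n , (u , v , a , b , q)) → inj₂ (u , v , a , (n , b) , q) }) ,
    [ (λ q → zero , q) , (λ { (u , v , a , (n , b) , q) → suc n , (u , v , a , b , q) }) ]′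

  comm-⊆l : ∀ {x y} → x ∼ y → var x ⊙ var y ⊆l var y ⊙ var x
  comm-⊆l {x} {y} x∼y (u , v , a , b , q) =
    [ y ] , [ x ] , ≈S-refl , ≈S-refl , ≈S-trans q (≈S-trans (≈S-++ a b) (≈S-swap [] [] x∼y))

  ≈⇒≐l : ∀ {e f} → e ≈ f → e ≐l f
  ≈⇒≐l ≈-refl                = id , id
  ≈⇒≐l (≈-sym p)             = Product.swap (≈⇒≐l p)
  ≈⇒≐l (≈-trans p q)         = ⊆l-trans (proj₁ (≈⇒≐l p)) (proj₁ (≈⇒≐l q))
                             , ⊆l-trans (proj₂ (≈⇒≐l q)) (proj₂ (≈⇒≐l p))
  ≈⇒≐l (⊕-cong p q)          = ⊕-mono-⊆l (proj₁ (≈⇒≐l p)) (proj₁ (≈⇒≐l q))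
                             , ⊕-mono-⊆l (proj₂ (≈⇒≐l p)) (proj₂ (≈⇒≐l q))
  ≈⇒≐l (⊙-cong p q)          = ⊙-mono-⊆l (proj₁ (≈⇒≐l p)) (proj₁ (≈⇒≐l q))
                             , ⊙-mono-⊆l (proj₂ (≈⇒≐l p)) (proj₂ (≈⇒≐l q))
  ≈⇒≐l (⋆-cong p)            = ⋆-mono-⊆l (proj₁ (≈⇒≐l p)) , ⋆-mono-⊆l (proj₂ (≈⇒≐l p))
  ≈⇒≐l (⊕-assoc e f g)       = assocʳ , assocˡ
  ≈⇒≐l (⊕-comm e f)          = swap , swap
  ≈⇒≐l (⊕-idem e)            = reduce , inj₁
  ≈⇒≐l (⊕-idʳ e)             = [ id , (λ ()) ]′ , inj₁
  ≈⇒≐l (⊙-assoc e f g)       = ⊙-assoc-⊆l e f g , ⊙-assoc⁻¹-⊆l e f g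
  ≈⇒≐l (⊙-idˡ e)             = ⊙-idˡ-≐l e
  ≈⇒≐l (⊙-idʳ e)             = ⊙-idʳ-≐l e
  ≈⇒≐l (distribˡ e f g)      = distribˡ-⊆l e f g , distribˡ⁻¹-⊆l e f g
  ≈⇒≐l (distribʳ e f g)      = distribʳ-⊆l e f g , distribʳ⁻¹-⊆l e f g
  ≈⇒≐l (zeroˡ e)             = (λ { (_ , _ , () , _) }) , λ ()
  ≈⇒≐l (zeroʳ e)             = (λ { (_ , _ , _ , () , _) }) , λ ()
  ≈⇒≐l (⋆-unfold e)          = ⋆-unfold-≐l e
  ≈⇒≐l (comm x∼y)            = comm-⊆l x∼y , comm-⊆l (∼-sym x∼y)

  ∈l-⌜⌝ : ∀ s → s ∈l ⌜ s ⌝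
  ∈l-⌜⌝ []      = ≈S-refl
  ∈l-⌜⌝ (x ∷ s) = [ x ] , s , ≈S-refl , ∈l-⌜⌝ s , ≈S-refl

  ≤⇒∈l : ∀ s e → ⌜ s ⌝ ≤ e → s ∈l e
  ≤⇒∈l s e s≤e = proj₁ (≈⇒≐l s≤e) (inj₁ (∈l-⌜⌝ s))

  ≈⇒≤ : ∀ {e f} → e ≈ f → e ≤ f
  ≈⇒≤ p = ≈-trans (⊕-cong p ≈-refl) (⊕-idem _)

  ≤-trans : ∀ {e f g} → e ≤ f → f ≤ g → e ≤ g
  ≤-trans {e} {f} {g} p q =
    ≈-trans (⊕-cong ≈-refl (≈-sym q)) (≈-trans (≈-sym (⊕-assoc e f g)) (≈-trans (⊕-cong p ≈-refl) q))

  ≤-⊕ˡ : ∀ e f → e ≤ e ⊕ f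
  ≤-⊕ˡ e f = ≈-trans (≈-sym (⊕-assoc e e f)) (⊕-cong (⊕-idem e) ≈-refl)

  ≤-⊕ʳ : ∀ e f → f ≤ e ⊕ f
  ≤-⊕ʳ e f = ≤-trans (≤-⊕ˡ f e) (≈⇒≤ (⊕-comm f e))

  ⊙-mono : ∀ {e e' f f'} → e ≤ e' → f ≤ f' → e ⊙ f ≤ e' ⊙ f'
  ⊙-mono {e' = e'} {f = f} p q =
    ≤-trans (≈-trans (≈-sym (distribʳ f _ _)) (⊙-cong p ≈-refl))
            (≈-trans (≈-sym (distribˡ e' _ _)) (⊙-cong ≈-refl q))

  ⌜++⌝ : ∀ u v → ⌜ u ++ v ⌝ ≈ ⌜ u ⌝ ⊙ ⌜ v ⌝
  ⌜++⌝ []      v = ≈-sym (⊙-idˡ _)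
  ⌜++⌝ (x ∷ u) v = ≈-trans (⊙-cong ≈-refl (⌜++⌝ u v)) (≈-sym (⊙-assoc _ _ _))

  ⌜⌝-cong : ∀ {s t} → s ≈S t → ⌜ s ⌝ ≈ ⌜ t ⌝
  ⌜⌝-cong ≈S-refl                = ≈-refl
  ⌜⌝-cong (≈S-sym p)             = ≈-sym (⌜⌝-cong p)
  ⌜⌝-cong (≈S-trans p q)         = ≈-trans (⌜⌝-cong p) (⌜⌝-cong q)
  ⌜⌝-cong (≈S-swap [] v x∼y)     =
    ≈-trans (≈-sym (⊙-assoc _ _ _)) (≈-trans (⊙-cong (comm x∼y) ≈-refl) (⊙-assoc _ _ _))
  ⌜⌝-cong (≈S-swap (x ∷ u) v x∼y) = ⊙-cong ≈-refl (⌜⌝-cong (≈S-swap u v x∼y))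

  ⌜⌝-concat-≤ : ∀ {s u v e f} → s ≈S u ++ v → ⌜ u ⌝ ≤ e → ⌜ v ⌝ ≤ f → ⌜ s ⌝ ≤ e ⊙ f
  ⌜⌝-concat-≤ {u = u} {v} q p₁ p₂ = ≤-trans (≈⇒≤ (≈-trans (⌜⌝-cong q) (⌜++⌝ u v))) (⊙-mono p₁ p₂)

  ≤-⋆-unfold : ∀ e {f} → f ≤ 𝟙 ⊕ e ⊙ e ⋆ → f ≤ e ⋆
  ≤-⋆-unfold e p = ≤-trans p (≈⇒≤ (≈-sym (⋆-unfold e)))

  mutual
    ∈l⇒≤ : ∀ s e → s ∈l e → ⌜ s ⌝ ≤ e
    ∈l⇒≤ s (var x) p                   = ≈⇒≤ (≈-trans (⌜⌝-cong p) (⊙-idʳ _))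
    ∈l⇒≤ s 𝟘       ()
    ∈l⇒≤ s 𝟙       p                   = ≈⇒≤ (⌜⌝-cong p)
    ∈l⇒≤ s (e ⊕ f) (inj₁ p)            = ≤-trans (∈l⇒≤ s e p) (≤-⊕ˡ e f)
    ∈l⇒≤ s (e ⊕ f) (inj₂ p)            = ≤-trans (∈l⇒≤ s f p) (≤-⊕ʳ e f)
    ∈l⇒≤ s (e ⊙ f) (u , v , a , b , q) = ⌜⌝-concat-≤ q (∈l⇒≤ u e a) (∈l⇒≤ v f b)
    ∈l⇒≤ s (e ⋆)   (n , p)             = ∈pow⇒≤⋆ s e n p

    ∈pow⇒≤⋆ : ∀ s e n → s ∈pow e ^ n → ⌜ s ⌝ ≤ e ⋆
    ∈pow⇒≤⋆ s e zero    p                   =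
      ≤-⋆-unfold e (≤-trans (≈⇒≤ (⌜⌝-cong p)) (≤-⊕ˡ 𝟙 (e ⊙ e ⋆)))
    ∈pow⇒≤⋆ s e (suc n) (u , v , a , b , q) =
      ≤-⋆-unfold e (≤-trans (⌜⌝-concat-≤ q (∈l⇒≤ u e a) (∈pow⇒≤⋆ v e n b)) (≤-⊕ʳ 𝟙 (e ⊙ e ⋆)))

mainTheorem4 : (X : CommutableSet) → let open Free X in
                 (s : Str) (e : Term) → (⌜ s ⌝ ≤ e) ⇔ (s ∈l e)
mainTheorem4 X s e = mk⇔ (≤⇒∈l s e) (∈l⇒≤ s e)
  where open Language X
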